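{- Let $G$ and $H$ be strongly connected, deterministic and co-deterministic graphs. If $\mathrm{L}_G(s,t)=\mathrm{L}_H(p,q)$ for some $s,t\in V_G$ and $p,q\in V_H$, then $G$ and $H$ are isomorphic.
   Context: Fix an arbitrary set $A$ of labels. A graph is a non-empty set $G\subseteq V\times A\times V$ of labelled edges $s\xrightarrow{a}t$; $V_G$ is the set of vertices occurring in edges. Isomorphism: bijection $f:V_G\to V_H$ with $s\xrightarrow{a}_G t\iff f(s)\xrightarrow{a}_H f(t)$. $G$ is deterministic if $r\xrightarrow{a}s,\ r\xrightarrow{a}t\Rightarrow s=t$; co-deterministic if $s\xrightarrow{a}r,\ t\xrightarrow{a}r\Rightarrow s=t$; strongly connected if every vertex reaches every vertex by a directed path. For a word $u=a_1\cdots a_n\in A^*$, $s\xrightarrow{u}t$ means there is a path $s=s_0\xrightarrow{a_1}s_1\cdots\xrightarrow{a_n}s_n=t$, and $\mathrm{L}_G(s,t)=\{u\in A^*\mid s\xrightarrow{u}_G t\}$. -}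

module Defs where

open import Data.List using (List; []; _∷_)
open import Data.Product using (Σ; ∃; _×_; _,_)
open import Data.Sum using (_⊎_)
open import Relation.Binary.PropositionalEquality using (_≡_)
open import Function.Bundles using (Bijection; _⤖_; _⇔_)

Word : Set → Set
Word A = List A

-- A graph over labels A: a set G ⊆ V × A × V of labelled edges.
-- We package it with its vertex set V_G (the carrier Vert, vertex equality
-- is _≡_), an edge relation that is proposition-valued (G is a *set* of
-- edges, so no multi-edges), every vertex occurs in some edge, and G is
-- non-empty.
record Graph (A : Set) : Set₁ where
  field
    Vert      : Set
    Edge      : Vert → A → Vert → Set
    edge-prop : ∀ {s a t} (e e′ : Edge s a t) → e ≡ e′
    occurs    : ∀ (v : Vert) → ∃ λ a → ∃ λ w → Edge v a w ⊎ Edge w a v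
    nonempty  : ∃ λ s → ∃ λ a → ∃ λ t → Edge s a t

open Graph public

module _ {A : Set} (G : Graph A) where

  data Path : Vert G → Word A → Vert G → Set where
    nil  : ∀ {s} → Path s [] s
    cons : ∀ {s r t a u} → Edge G s a r → Path r u t → Path s (a ∷ u) t

  L : Vert G → Vert G → Word A → Set
  L s t u = Path s u t

  Deterministic : Set
  Deterministic = ∀ {r s t a} → Edge G r a s → Edge G r a t → s ≡ t

  CoDeterministic : Set
  CoDeterministic = ∀ {r s t a} → Edge G s a r → Edge G t a r → s ≡ t

  StronglyConnected : Set
  StronglyConnected = ∀ (s t : Vert G) → ∃ λ u → Path s u t

record _≅_ {A : Set} (G H : Graph A) : Set where
  field
    bij      : Vert G ⤖ Vert H
    preserve : ∀ (s : Vert G) (a : A) (t : Vert G) →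
               Edge G s a t ⇔ Edge H (Bijection.to bij s) a (Bijection.to bij t)

-- Let G be strongly connected and H deterministic and
-- co-deterministic, with L_G(s,t) ⊆ L_H(p,q).  For a vertex v of G choose
-- paths s -x-> v -y-> t; then xy ∈ L_H(p,q), so there is a vertex m of H
-- with p -x-> m -y-> q.  Determinism (for a common prefix) and
-- co-determinism (for a common suffix) of H show that m does not depend on
-- the chosen x, y: this defines a map f : V_G → V_H such that every
-- factorisation s -x-> v -y-> t in G gives p -x-> f v -y-> q in H.
-- Applying this to s -x-> v -a-> w -y-> t shows that f preserves edges.
--
-- Under the hypotheses of the corollary the construction runs both ways,
-- giving edge-preserving maps f : G → H and g : H → G.  Since p -x-> f v
-- transfers back to s -x-> g (f v), determinism of G yields g (f v) = v, and
-- symmetrically f (g w) = w.  Mutually inverse edge-preserving maps form an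
-- isomorphism, which is the corollary.
module Submission where

open import Defs
open import Data.List using ([]; _∷_; _++_; [_])
open import Data.Product using (_×_; Σ; _,_; proj₁; proj₂)
open import Function.Bundles using (_⇔_; Equivalence; mk⤖; mk⇔)
open import Function.Definitions using (Injective; Surjective)
open import Relation.Binary.PropositionalEquality using (_≡_; refl; sym; trans; cong; subst₂; module ≡-Reasoning)

module _ {A : Set} (G : Graph A) where

  splitPath : ∀ (x : Word A) {y s t} → Path G s (x ++ y) t →
              Σ (Vert G) λ m → Path G s x m × Path G m y t
  splitPath []      π          = _ , nil , π
  splitPath (a ∷ x) (cons e π) with splitPath x π
  ... | m , πx , πy = m , cons e πx , πy

  joinPath : ∀ {x y s m t} → Path G s x m → Path G m y t → Path G s (x ++ y) t
  joinPath nil        πy = πy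
  joinPath (cons e πx) πy = cons e (joinPath πx πy)

  det-target : Deterministic G → ∀ {x s t t′} → Path G s x t → Path G s x t′ → t ≡ t′
  det-target det nil        nil         = refl
  det-target det (cons e π) (cons e′ π′) with det e e′
  ... | refl = det-target det π π′

  det-step : Deterministic G → ∀ {x a s m m′} → Path G s x m → Path G s (x ++ [ a ]) m′ →
             Edge G m a m′
  det-step det {x} π πa with splitPath x πa
  ... | _ , π′ , cons e nil rewrite det-target det π′ π = e

  codet-source : CoDeterministic G → ∀ {y s s′ t} → Path G s y t → Path G s′ y t → s ≡ s′
  codet-source codet nil        nil         = refl
  codet-source codet (cons e π) (cons e′ π′) with codet-source codet π π′
  ... | refl = codet e e′

module Transfer {A : Set} (G H : Graph A) (scG : StronglyConnected G)
                (detH : Deterministic H) (codetH : CoDeterministic H)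
                (s t : Vert G) (p q : Vert H)
                (incl : ∀ u → L G s t u → L H p q u) where

  middle : ∀ {x y v} → Path G s x v → Path G v y t →
           Σ (Vert H) λ m → Path H p x m × Path H m y q
  middle {x} πx πy = splitPath H x (incl _ (joinPath G πx πy))

  -- The middle vertex only depends on v: two factorisations through v are
  -- compared via a third sharing its suffix with one and its prefix with
  -- the other.
  middle-unique : ∀ {x y x′ y′ v} (πx : Path G s x v) (πy : Path G v y t)
                  (πx′ : Path G s x′ v) (πy′ : Path G v y′ t) →
                  proj₁ (middle πx πy) ≡ proj₁ (middle πx′ πy′)
  middle-unique πx πy πx′ πy′ with middle πx πy | middle πx′ πy | middle πx′ πy′
  ... | _ , _ , ρy | _ , ρx″ , ρy″ | _ , ρx′ , _ =
    trans (codet-source H codetH ρy ρy″) (det-target H detH ρx″ ρx′)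

  f : Vert G → Vert H
  f v = proj₁ (middle (proj₂ (scG s v)) (proj₂ (scG v t)))

  transfer : ∀ {x y v} → Path G s x v → Path G v y t →
             Path H p x (f v) × Path H (f v) y q
  transfer πx πy with middle πx πy | middle-unique πx πy (proj₂ (scG s _)) (proj₂ (scG _ t))
  ... | _ , ρx , ρy | refl = ρx , ρy

  -- f is a graph homomorphism: the H-images of the factorisations of x a y
  -- at v and at w read x to f v and x a to f w respectively.
  f-edge : ∀ {v a w} → Edge G v a w → Edge H (f v) a (f w)
  f-edge {v} {w = w} e =
    det-step H detH (proj₁ (transfer πx (cons e πy)))
                    (proj₁ (transfer (joinPath G πx (cons e nil)) πy))
    where
    πx : Path G s (proj₁ (scG s v)) v
    πx = proj₂ (scG s v)
    πy : Path G w (proj₁ (scG w t)) t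
    πy = proj₂ (scG w t)

inverse-homomorphisms⇒≅ : {A : Set} (G H : Graph A)
  (f : Vert G → Vert H) (g : Vert H → Vert G) →
  (∀ {v a w} → Edge G v a w → Edge H (f v) a (f w)) →
  (∀ {v a w} → Edge H v a w → Edge G (g v) a (g w)) →
  (∀ v → g (f v) ≡ v) → (∀ w → f (g w) ≡ w) → G ≅ H
inverse-homomorphisms⇒≅ G H f g f-edge g-edge gf fg = record
  { bij      = mk⤖ {to = f} (injective , surjective)
  ; preserve = λ v a w → mk⇔ f-edge (λ e → subst₂ (λ x y → Edge G x a y) (gf v) (gf w) (g-edge e))
  }
  where
  injective : Injective _≡_ _≡_ f
  injective {v} {v′} fv≡fv′ = begin
    v         ≡⟨ sym (gf v) ⟩
    g (f v)   ≡⟨ cong g fv≡fv′ ⟩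
    g (f v′)  ≡⟨ gf v′ ⟩
    v′        ∎
    where open ≡-Reasoning

  surjective : Surjective _≡_ _≡_ f
  surjective w = g w , λ { refl → fg w }

-- If transfers G → H and H → G both exist, they are mutually inverse: the
-- canonical path s -x-> v goes to p -x-> f v and back to s -x-> g (f v), so
-- determinism of G forces g (f v) = v.
module RoundTrip {A : Set} (G H : Graph A)
                 (scG : StronglyConnected G) (detG : Deterministic G) (codetG : CoDeterministic G)
                 (scH : StronglyConnected H) (detH : Deterministic H) (codetH : CoDeterministic H)
                 (s t : Vert G) (p q : Vert H)
                 (GtoH : ∀ u → L G s t u → L H p q u) (HtoG : ∀ u → L H p q u → L G s t u) where
  module F = Transfer G H scG detH codetH s t p q GtoH
  module B = Transfer H G scH detG codetG p q s t HtoG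

  back-and-forth : ∀ v → B.f (F.f v) ≡ v
  back-and-forth v with F.transfer (proj₂ (scG s v)) (proj₂ (scG v t))
  ... | ρx , ρy = det-target G detG (proj₁ (B.transfer ρx ρy)) (proj₂ (scG s v))

corollary2p8 : {A : Set} (G H : Graph A) →
    StronglyConnected G → Deterministic G → CoDeterministic G →
    StronglyConnected H → Deterministic H → CoDeterministic H →
    (s t : Vert G) (p q : Vert H) →
    (∀ u → L G s t u ⇔ L H p q u) →
    G ≅ H
corollary2p8 G H scG detG codetG scH detH codetH s t p q L≡ =
  inverse-homomorphisms⇒≅ G H GH.F.f GH.B.f GH.F.f-edge GH.B.f-edge
    GH.back-and-forth HG.back-and-forth
  where
  GtoH : ∀ u → L G s t u → L H p q u
  GtoH u = Equivalence.to (L≡ u)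

  HtoG : ∀ u → L H p q u → L G s t u
  HtoG u = Equivalence.from (L≡ u)

  module GH = RoundTrip G H scG detG codetG scH detH codetH s t p q GtoH HtoG
  module HG = RoundTrip H G scH detH codetH scG detG codetG p q s t HtoG GtoH
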